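{- Let $G$ be an edge-weighted graph with at least one edge, let $w_0$ be the largest edge weight of $G$, and let $u$ be a vertex of $G$. Then $\mathrm{OPT}(G-u)\geq \mathrm{OPT}(G)-w_0$.
   Context: Graphs are finite, simple, undirected, with positive edge weights; the weight of a matching is the sum of its edge weights. With distinct edge weights $w_1>\dots>w_\ell$, a greedy matching is any matching that can be output by: $\mathcal{M}\leftarrow\emptyset$; for $i=1,\dots,\ell$, while the current edge set contains an edge of weight $w_i$, pick any such edge $e^*$, add it to $\mathcal{M}$ and delete all edges sharing an endpoint with $e^*$. $\mathrm{OPT}(G)$ is the maximum weight of a greedy matching of $G$ (equal to 0 if $G$ has no edges). $G-u$ denotes the subgraph induced by $V(G)\setminus\{u\}$.
   Formalization: The edge weights of G are positive rationals. -}

module Defs where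

open import Data.Nat using (ℕ; suc)
open import Data.Fin using (Fin; punchIn; _≟_)
open import Data.Maybe using (Maybe; just; nothing)
open import Data.Rational using (ℚ; _≤_; _+_; 0ℚ; Positive)
open import Data.List using (List; []; _∷_)
open import Data.Product using (Σ; ∃; _×_; _,_)
open import Data.Bool using (if_then_else_)
open import Relation.Nullary.Decidable using (⌊_⌋)
open import Relation.Binary.PropositionalEquality using (_≡_)

-- Edge weights on vertex set Fin n: W i j ≡ just w means {i,j} is an edge of weight w,
-- W i j ≡ nothing means no edge.
Weights : ℕ → Set
Weights n = Fin n → Fin n → Maybe ℚ

record WGraph (n : ℕ) : Set where
  field
    W     : Weights n
    sym   : ∀ i j → W i j ≡ W j i
    loopless : ∀ i → W i i ≡ nothing
    pos   : ∀ i j w → W i j ≡ just w → Positive w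
open WGraph public

_-v_ : ∀ {m} → WGraph (suc m) → Fin (suc m) → WGraph m
W (G -v u) i j = W G (punchIn u i) (punchIn u j)
sym (G -v u) i j = sym G (punchIn u i) (punchIn u j)
loopless (G -v u) i = loopless G (punchIn u i)
pos (G -v u) i j w e = pos G (punchIn u i) (punchIn u j) w e

deleteAdj : ∀ {n} → Fin n → Fin n → Weights n → Weights n
deleteAdj a b C k l =
  if ⌊ k ≟ a ⌋ then nothing else
  if ⌊ k ≟ b ⌋ then nothing else
  if ⌊ l ≟ a ⌋ then nothing else
  if ⌊ l ≟ b ⌋ then nothing else C k l

Matching : ℕ → Set
Matching n = List (Fin n × Fin n × ℚ)

weight : ∀ {n} → Matching n → ℚ
weight [] = 0ℚ
weight ((_ , _ , w) ∷ M) = w + weight M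

-- Processing the distinct weights in decreasing order and picking any edge of the
-- current weight w_i is the same as repeatedly picking any edge whose weight is
-- maximal among the remaining edges; the run ends when no edges remain.
data GreedyRun {n : ℕ} : Weights n → Matching n → Set where
  done : ∀ {C} → (∀ i j → C i j ≡ nothing) → GreedyRun C []
  step : ∀ {C M} (i j : Fin n) (w : ℚ) →
         C i j ≡ just w →
         (∀ k l w' → C k l ≡ just w' → w' ≤ w) →
         GreedyRun (deleteAdj i j C) M →
         GreedyRun C ((i , j , w) ∷ M)

IsGreedy : ∀ {n} → WGraph n → Matching n → Set
IsGreedy G M = GreedyRun (W G) M

-- x = OPT(G): x is the weight of some greedy matching, and every greedy matching
-- has weight ≤ x.  (For G without edges this forces x = 0.)
IsOPT : ∀ {n} → WGraph n → ℚ → Set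
IsOPT G x = (∃ λ M → IsGreedy G M × weight M ≡ x) × (∀ M → IsGreedy G M → weight M ≤ x)

IsMaxWeight : ∀ {n} → WGraph n → ℚ → Set
IsMaxWeight G w0 = (∃ λ i → ∃ λ j → W G i j ≡ just w0) × (∀ i j w → W G i j ≡ just w → w ≤ w0)

module Submission where

-- Write  isolate u C  for the edge set C with every edge at u deleted.  The proof
-- rests on two exchange lemmas about runs of the greedy algorithm, proved by a
-- simultaneous induction on the length of the run:
--
--  (isolate-loss)   every greedy run M on C yields a greedy run N on isolate u C
--                   with  w(M) ≤ w(N) + W, where W bounds all weights of C;
--  (restore-gain)   every greedy run M on isolate v D yields a greedy run N on D
--                   with  w(M) ≤ w(N).
--
-- If the first greedy edge {i,j} of C avoids u, it is also a legal first choice on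
-- isolate u C and we recurse.  If it contains u, then after taking it the rest of
-- the run lives on isolate j (isolate u C), and restore-gain loses at most its
-- weight w ≤ W.  For restore-gain, if the heaviest edge {v,x} at v is no heavier
-- than the greedy edge of isolate v D, the run is also a run on D; otherwise D
-- takes {v,x} first, leaving isolate x (isolate v D), and isolate-loss applies.
--
-- Finally a run avoiding u transfers to G - u without changing its weight.

open import Defs hiding (sym)
open import Data.Nat using (ℕ; suc)
open import Data.Fin using (Fin; zero; suc; punchIn; punchOut; _≟_)
open import Data.Fin.Properties using (punchIn-injective; punchInᵢ≢i; punchIn-punchOut)
open import Data.Rational using (ℚ; _≤_; _-_; _+_; -_; 0ℚ)
import Data.Rational.Properties as ℚ
open import Data.Maybe using (Maybe; just; nothing)
open import Data.Maybe.Properties using (just-injective)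
open import Data.Bool using (Bool; true; false; if_then_else_; _∨_)
open import Data.Bool.Properties using (∨-comm; ∨-idempotentCommutativeMonoid)
open import Data.List using ([]; _∷_)
open import Data.Product using (∃; _×_; _,_; proj₁; proj₂)
open import Data.Sum using (_⊎_; inj₁; inj₂)
open import Relation.Nullary using (¬_; yes; no; contradiction)
open import Relation.Nullary.Decidable using (⌊_⌋)
open import Relation.Binary.PropositionalEquality
open import Algebra.Solver.IdempotentCommutativeMonoid ∨-idempotentCommutativeMonoid
  using (solve; _⊜_; _⊕_)

-- Pointwise equality of edge sets (there is no function extensionality).
_≈_ : ∀ {n} → Weights n → Weights n → Set
E ≈ F = ∀ k l → E k l ≡ F k l

≈-sym : ∀ {n} {E F : Weights n} → E ≈ F → F ≈ E
≈-sym p k l = sym (p k l)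

≈-trans : ∀ {n} {E F H : Weights n} → E ≈ F → F ≈ H → E ≈ H
≈-trans p q k l = trans (p k l) (q k l)

isolate : ∀ {n} → Fin n → Weights n → Weights n
isolate u C = deleteAdj u u C

hits : ∀ {n} → Fin n → Fin n → Fin n → Fin n → Bool
hits a b k l = ⌊ k ≟ a ⌋ ∨ ⌊ k ≟ b ⌋ ∨ ⌊ l ≟ a ⌋ ∨ ⌊ l ≟ b ⌋

-- deleteAdj as a single test; this reduces all identities below to Boolean algebra.
deleteAdj-hits : ∀ {n} a b (C : Weights n) k l →
                 deleteAdj a b C k l ≡ (if hits a b k l then nothing else C k l)
deleteAdj-hits a b C k l with ⌊ k ≟ a ⌋ | ⌊ k ≟ b ⌋ | ⌊ l ≟ a ⌋ | ⌊ l ≟ b ⌋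
... | true  | _     | _     | _     = refl
... | false | true  | _     | _     = refl
... | false | false | true  | _     = refl
... | false | false | false | true  = refl
... | false | false | false | false = refl

if-∨ : ∀ p q (x : Maybe ℚ) →
       (if p then nothing else (if q then nothing else x)) ≡ (if p ∨ q then nothing else x)
if-∨ true  q x = refl
if-∨ false q x = refl

deleteAdj-twice : ∀ {n} a b c d (C : Weights n) k l →
                  deleteAdj a b (deleteAdj c d C) k l ≡ (if hits a b k l ∨ hits c d k l then nothing else C k l)
deleteAdj-twice a b c d C k l = begin
  deleteAdj a b (deleteAdj c d C) k l
    ≡⟨ deleteAdj-hits a b (deleteAdj c d C) k l ⟩
  (if hits a b k l then nothing else deleteAdj c d C k l)
    ≡⟨ cong (if hits a b k l then nothing else_) (deleteAdj-hits c d C k l) ⟩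
  (if hits a b k l then nothing else (if hits c d k l then nothing else C k l))
    ≡⟨ if-∨ (hits a b k l) (hits c d k l) (C k l) ⟩
  (if hits a b k l ∨ hits c d k l then nothing else C k l) ∎
  where open ≡-Reasoning

deleteAdj-cong : ∀ {n} a b {E F : Weights n} → E ≈ F → deleteAdj a b E ≈ deleteAdj a b F
deleteAdj-cong a b {E} {F} E≈F k l = begin
  deleteAdj a b E k l                       ≡⟨ deleteAdj-hits a b E k l ⟩
  (if hits a b k l then nothing else E k l) ≡⟨ cong (if hits a b k l then nothing else_) (E≈F k l) ⟩
  (if hits a b k l then nothing else F k l) ≡⟨ deleteAdj-hits a b F k l ⟨
  deleteAdj a b F k l ∎
  where open ≡-Reasoning

deleteAdj-comm : ∀ {n} a b c d (C : Weights n) → deleteAdj a b (deleteAdj c d C) ≈ deleteAdj c d (deleteAdj a b C)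
deleteAdj-comm a b c d C k l = begin
  deleteAdj a b (deleteAdj c d C) k l
    ≡⟨ deleteAdj-twice a b c d C k l ⟩
  (if hits a b k l ∨ hits c d k l then nothing else C k l)
    ≡⟨ cong (if_then nothing else C k l) (∨-comm (hits a b k l) (hits c d k l)) ⟩
  (if hits c d k l ∨ hits a b k l then nothing else C k l)
    ≡⟨ deleteAdj-twice c d a b C k l ⟨
  deleteAdj c d (deleteAdj a b C) k l ∎
  where open ≡-Reasoning

deleteAdj-split : ∀ {n} a b (C : Weights n) → deleteAdj a b C ≈ isolate b (isolate a C)
deleteAdj-split a b C k l = begin
  deleteAdj a b C k l
    ≡⟨ deleteAdj-hits a b C k l ⟩
  (if hits a b k l then nothing else C k l)
    ≡⟨ cong (if_then nothing else C k l) (both-ends ⌊ k ≟ a ⌋ ⌊ k ≟ b ⌋ ⌊ l ≟ a ⌋ ⌊ l ≟ b ⌋) ⟩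
  (if hits b b k l ∨ hits a a k l then nothing else C k l)
    ≡⟨ deleteAdj-twice b b a a C k l ⟨
  isolate b (isolate a C) k l ∎
  where
    open ≡-Reasoning
    both-ends : ∀ p q r s → (p ∨ q ∨ r ∨ s) ≡ ((q ∨ q ∨ s ∨ s) ∨ (p ∨ p ∨ r ∨ r))
    both-ends = solve 4 (λ p q r s → (p ⊕ q ⊕ r ⊕ s) ⊜ ((q ⊕ q ⊕ s ⊕ s) ⊕ (p ⊕ p ⊕ r ⊕ r))) refl

deleteAdj-split′ : ∀ {n} a b (C : Weights n) → deleteAdj a b C ≈ isolate a (isolate b C)
deleteAdj-split′ a b C = ≈-trans (deleteAdj-split a b C) (deleteAdj-comm b b a a C)

_⊆_ : ∀ {n} → Weights n → Weights n → Set
E ⊆ C = ∀ k l w → E k l ≡ just w → C k l ≡ just w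

deleteAdj-⊆ : ∀ {n} a b (C : Weights n) → deleteAdj a b C ⊆ C
deleteAdj-⊆ a b C k l w eq = surviving (hits a b k l) (trans (sym (deleteAdj-hits a b C k l)) eq)
  where
    surviving : ∀ t {x : Maybe ℚ} → (if t then nothing else x) ≡ just w → x ≡ just w
    surviving false eq = eq

AllWeights : ∀ {n} → (ℚ → Set) → Weights n → Set
AllWeights P C = ∀ k l w → C k l ≡ just w → P w

⊆-allWeights : ∀ {n} {P : ℚ → Set} {E C : Weights n} → E ⊆ C → AllWeights P C → AllWeights P E
⊆-allWeights E⊆C all k l w eq = all k l w (E⊆C k l w eq)

Empty : ∀ {n} → Weights n → Set
Empty C = ∀ k l → C k l ≡ nothing

⊆-empty : ∀ {n} {E C : Weights n} → E ⊆ C → Empty C → Empty E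
⊆-empty {E = E} E⊆C empty k l with E k l in eq
... | nothing = refl
... | just w  with () ← trans (sym (empty k l)) (E⊆C k l w eq)

isolate-keep : ∀ {n} u (C : Weights n) k l → ¬ k ≡ u → ¬ l ≡ u → isolate u C k l ≡ C k l
isolate-keep u C k l k≢u l≢u with k ≟ u | l ≟ u
... | yes k≡u | _       = contradiction k≡u k≢u
... | no _    | yes l≡u = contradiction l≡u l≢u
... | no _    | no _    = refl

Touches : ∀ {n} → Fin n → Fin n → Fin n → Set
Touches v k l = k ≡ v ⊎ l ≡ v

touches-or-isolate : ∀ {n} v (D : Weights n) k l {w} → D k l ≡ just w →
                     Touches v k l ⊎ isolate v D k l ≡ just w
touches-or-isolate v D k l eq with k ≟ v | l ≟ v
... | yes k≡v | _       = inj₁ (inj₁ k≡v)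
... | no _    | yes l≡v = inj₁ (inj₂ l≡v)
... | no _    | no _    = inj₂ eq

run-resp : ∀ {n} {E F : Weights n} {M} → E ≈ F → GreedyRun E M → GreedyRun F M
run-resp E≈F (done empty) = done (λ k l → trans (sym (E≈F k l)) (empty k l))
run-resp E≈F (step i j w eq max run) =
  step i j w (trans (sym (E≈F i j)) eq)
             (λ k l w′ p → max k l w′ (trans (E≈F k l) p))
             (run-resp (deleteAdj-cong i j E≈F) run)

MaxAt : ∀ {n} → (Fin n → Maybe ℚ) → Fin n → ℚ → Set
MaxAt f x e = f x ≡ just e × (∀ y e′ → f y ≡ just e′ → e′ ≤ e)

partialMax : ∀ {n} (f : Fin n → Maybe ℚ) → (∀ x → f x ≡ nothing) ⊎ ∃ λ x → ∃ λ e → MaxAt f x e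
partialMax {ℕ.zero} f = inj₁ λ ()
partialMax {suc n} f with partialMax (λ x → f (suc x)) | f zero in f0
... | inj₁ none | nothing = inj₁ λ { zero → f0 ; (suc x) → none x }
... | inj₁ none | just e  = inj₂ (zero , e , f0 , λ
      { zero e′ p → ℚ.≤-reflexive (just-injective (trans (sym p) f0))
      ; (suc y) e′ p → contradiction (trans (sym (none y)) p) λ () })
... | inj₂ (x , e , fx , max) | nothing = inj₂ (suc x , e , fx , λ
      { zero e′ p → contradiction (trans (sym f0) p) λ ()
      ; (suc y) e′ p → max y e′ p })
... | inj₂ (x , e , fx , max) | just e₀ with ℚ.≤-total e₀ e
...   | inj₁ e₀≤e = inj₂ (suc x , e , fx , λ
        { zero e′ p → ℚ.≤-trans (ℚ.≤-reflexive (just-injective (trans (sym p) f0))) e₀≤e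
        ; (suc y) e′ p → max y e′ p })
...   | inj₂ e≤e₀ = inj₂ (zero , e₀ , f0 , λ
        { zero e′ p → ℚ.≤-reflexive (just-injective (trans (sym p) f0))
        ; (suc y) e′ p → ℚ.≤-trans (max y e′ p) e≤e₀ })

-- Either no edge of D touches v, or there is a heaviest such edge {a,b}, with other
-- endpoint x; taking it leaves exactly  isolate x (isolate v D).
data HeaviestAt {n} (D : Weights n) (v : Fin n) : Set where
  untouched : (∀ k l w → D k l ≡ just w → ¬ Touches v k l) → HeaviestAt D v
  heaviest  : (a b x : Fin n) (e : ℚ) → D a b ≡ just e →
              deleteAdj a b D ≈ isolate x (isolate v D) →
              (∀ k l w → D k l ≡ just w → Touches v k l → w ≤ e) → HeaviestAt D v

-- Compare the heaviest edge in the row of v with the heaviest in its column.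
heaviestAt : ∀ {n} (D : Weights n) v → HeaviestAt D v
heaviestAt D v with partialMax (D v) | partialMax (λ x → D x v)
... | inj₁ row | inj₁ col = untouched absent
  where
    absent : ∀ k l w → D k l ≡ just w → ¬ Touches v k l
    absent k l w eq (inj₁ refl) = contradiction (trans (sym (row l)) eq) λ ()
    absent k l w eq (inj₂ refl) = contradiction (trans (sym (col k)) eq) λ ()
... | inj₂ (x , e , Dvx , rowMax) | inj₁ col = heaviest v x x e Dvx (deleteAdj-split v x D) bound
  where
    bound : ∀ k l w → D k l ≡ just w → Touches v k l → w ≤ e
    bound k l w eq (inj₁ refl) = rowMax l w eq
    bound k l w eq (inj₂ refl) = contradiction (trans (sym (col k)) eq) λ ()
... | inj₁ row | inj₂ (y , e , Dyv , colMax) = heaviest y v y e Dyv (deleteAdj-split′ y v D) bound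
  where
    bound : ∀ k l w → D k l ≡ just w → Touches v k l → w ≤ e
    bound k l w eq (inj₁ refl) = contradiction (trans (sym (row l)) eq) λ ()
    bound k l w eq (inj₂ refl) = colMax k w eq
... | inj₂ (x , e₁ , Dvx , rowMax) | inj₂ (y , e₂ , Dyv , colMax) with ℚ.≤-total e₂ e₁
...   | inj₁ e₂≤e₁ = heaviest v x x e₁ Dvx (deleteAdj-split v x D) bound
  where
    bound : ∀ k l w → D k l ≡ just w → Touches v k l → w ≤ e₁
    bound k l w eq (inj₁ refl) = rowMax l w eq
    bound k l w eq (inj₂ refl) = ℚ.≤-trans (colMax k w eq) e₂≤e₁
...   | inj₂ e₁≤e₂ = heaviest y v y e₂ Dyv (deleteAdj-split′ y v D) bound
  where
    bound : ∀ k l w → D k l ≡ just w → Touches v k l → w ≤ e₂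
    bound k l w eq (inj₁ refl) = ℚ.≤-trans (rowMax l w eq) e₁≤e₂
    bound k l w eq (inj₂ refl) = colMax k w eq

restore-max : ∀ {n} v (D : Weights n) {w} → AllWeights (_≤ w) (isolate v D) →
              (∀ k l w′ → D k l ≡ just w′ → Touches v k l → w′ ≤ w) → AllWeights (_≤ w) D
restore-max v D maxIso maxAt k l w′ eq with touches-or-isolate v D k l eq
... | inj₁ touch = maxAt k l w′ eq touch
... | inj₂ eq′   = maxIso k l w′ eq′

swap-bound : ∀ {w W x y} → w ≤ W → x ≤ y → w + x ≤ y + W
swap-bound {w} {W} {x} {y} w≤W x≤y =
  ℚ.≤-trans (ℚ.+-mono-≤ w≤W x≤y) (ℚ.≤-reflexive (ℚ.+-comm W y))

-- All weights are nonnegative, so taking an edge never lowers the weight of a run.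
NonNeg : ∀ {n} → Weights n → Set
NonNeg = AllWeights (0ℚ ≤_)

-- The recursion is on the length of the run: every call shortens it, except that
-- restore-gain hands its whole run to isolate-loss, which then shortens it.
mutual
  isolate-loss : ∀ {n} {C : Weights n} {M} u {W} → 0ℚ ≤ W → NonNeg C → AllWeights (_≤ W) C →
                 GreedyRun C M → ∃ λ N → GreedyRun (isolate u C) N × weight M ≤ weight N + W
  isolate-loss {C = C} u {W} 0≤W nonneg bounded (done empty) =
    [] , done (⊆-empty (deleteAdj-⊆ u u C) empty) , ℚ.≤-trans 0≤W (ℚ.≤-reflexive (sym (ℚ.+-identityˡ W)))
  isolate-loss {C = C} u 0≤W nonneg bounded (step i j w eq max run) with u ≟ i | u ≟ j
  -- The greedy edge {u,j} is lost; the rest of the run lives on isolate j (isolate u C).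
  ... | yes refl | _ with restore-gain j (⊆-allWeights (deleteAdj-⊆ u u C) nonneg)
                                         (run-resp (deleteAdj-split u j C) run)
  ...   | N , runN , gain = N , runN , swap-bound (bounded i j w eq) gain
  isolate-loss {C = C} u 0≤W nonneg bounded (step i j w eq max run) | no _ | yes refl
    with restore-gain i (⊆-allWeights (deleteAdj-⊆ u u C) nonneg) (run-resp (deleteAdj-split′ i u C) run)
  ...   | N , runN , gain = N , runN , swap-bound (bounded i j w eq) gain
  -- The greedy edge avoids u, so isolate u C may take it too.
  isolate-loss {C = C} u 0≤W nonneg bounded (step i j w eq max run) | no u≢i | no u≢j
    with isolate-loss u 0≤W (⊆-allWeights (deleteAdj-⊆ i j C) nonneg)
                            (⊆-allWeights (deleteAdj-⊆ i j C) bounded) run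
  ... | N , runN , loss =
    (i , j , w) ∷ N ,
    step i j w (trans (isolate-keep u C i j (≢-sym u≢i) (≢-sym u≢j)) eq)
               (⊆-allWeights (deleteAdj-⊆ u u C) max)
               (run-resp (deleteAdj-comm u u i j C) runN) ,
    ℚ.≤-trans (ℚ.+-monoʳ-≤ w loss) (ℚ.≤-reflexive (sym (ℚ.+-assoc w (weight N) _)))

  restore-gain : ∀ {n} {D : Weights n} {M} v → NonNeg D →
                 GreedyRun (isolate v D) M → ∃ λ N → GreedyRun D N × weight M ≤ weight N
  restore-gain {D = D} v nonneg (done empty) with heaviestAt D v
  ... | untouched absent = [] , done onlyAtV , ℚ.≤-refl
    where
      onlyAtV : Empty D
      onlyAtV k l with D k l in eq
      ... | nothing = refl
      ... | just w with touches-or-isolate v D k l eq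
      ...   | inj₁ touch = contradiction touch (absent k l w eq)
      ...   | inj₂ eq′   with () ← trans (sym (empty k l)) eq′
  ... | heaviest a b x e Dab taken maxAt =
    (a , b , e) ∷ [] ,
    step a b e Dab (restore-max v D (λ k l w′ p → contradiction (trans (sym (empty k l)) p) λ ()) maxAt)
         (done (λ k l → trans (taken k l) (⊆-empty (deleteAdj-⊆ x x _) empty k l))) ,
    ℚ.≤-trans (nonneg a b e Dab) (ℚ.≤-reflexive (sym (ℚ.+-identityʳ e)))
  restore-gain {D = D} v nonneg (step i j w eq max run) with heaviestAt D v
  ... | untouched absent =
    restore-step v nonneg eq max run (λ k l w′ p touch → contradiction touch (absent k l w′ p))
  ... | heaviest a b x e Dab taken maxAt with ℚ.≤-total e w
  ...   | inj₁ e≤w = restore-step v nonneg eq max run (λ k l w′ p touch → ℚ.≤-trans (maxAt k l w′ p touch) e≤w)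
  -- D takes its heavier edge {a,b} first, leaving isolate x (isolate v D).
  ...   | inj₂ w≤e
    with isolate-loss x (nonneg a b e Dab) (⊆-allWeights (deleteAdj-⊆ v v D) nonneg)
                        (λ k l w′ p → ℚ.≤-trans (max k l w′ p) w≤e) (step i j w eq max run)
  ...     | N , runN , loss =
    (a , b , e) ∷ N ,
    step a b e Dab (restore-max v D (λ k l w′ p → ℚ.≤-trans (max k l w′ p) w≤e) maxAt)
                   (run-resp (≈-sym taken) runN) ,
    ℚ.≤-trans loss (ℚ.≤-reflexive (ℚ.+-comm (weight N) e))

  restore-step : ∀ {n} {D : Weights n} {M} v {i j w} → NonNeg D →
                 isolate v D i j ≡ just w → AllWeights (_≤ w) (isolate v D) →
                 GreedyRun (deleteAdj i j (isolate v D)) M →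
                 (∀ k l w′ → D k l ≡ just w′ → Touches v k l → w′ ≤ w) →
                 ∃ λ N → GreedyRun D N × weight ((i , j , w) ∷ M) ≤ weight N
  restore-step {D = D} v {i} {j} {w} nonneg eq max run maxAt
    with restore-gain v (⊆-allWeights (deleteAdj-⊆ i j D) nonneg) (run-resp (deleteAdj-comm i j v v D) run)
  ... | N , runN , gain =
    (i , j , w) ∷ N , step i j w (deleteAdj-⊆ v v D i j w eq) (restore-max v D max maxAt) runN ,
    ℚ.+-monoʳ-≤ w gain

-- The edge set on the remaining vertices; W (G -v u) is restrict u (W G).
restrict : ∀ {m} → Fin (suc m) → Weights (suc m) → Weights m
restrict u C i j = C (punchIn u i) (punchIn u j)

Avoids : ∀ {n} → Fin n → Weights n → Set
Avoids u C = ∀ k l w → C k l ≡ just w → ¬ k ≡ u × ¬ l ≡ u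

⊆-avoids : ∀ {n} {u} {E C : Weights n} → E ⊆ C → Avoids u C → Avoids u E
⊆-avoids E⊆C avoids k l w eq = avoids k l w (E⊆C k l w eq)

isolate-avoids : ∀ {n} u (C : Weights n) → Avoids u (isolate u C)
-- (the cases k ≡ u or l ≡ u are absurd, as eq then reads nothing ≡ just w)
isolate-avoids u C k l w eq with k ≟ u | l ≟ u
... | no k≢u | no l≢u = k≢u , l≢u

restrict-isolate : ∀ {m} (u : Fin (suc m)) (C : Weights (suc m)) → restrict u (isolate u C) ≈ restrict u C
restrict-isolate u C k l = isolate-keep u C (punchIn u k) (punchIn u l) (punchInᵢ≢i u k) (punchInᵢ≢i u l)

preimage : ∀ {m} (u i : Fin (suc m)) → ¬ i ≡ u → ∃ λ i′ → punchIn u i′ ≡ i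
preimage u i i≢u = punchOut (≢-sym i≢u) , punchIn-punchOut (≢-sym i≢u)

-- Since punchIn u is injective, it preserves the tests made by deleteAdj.
restrict-deleteAdj : ∀ {m} (u : Fin (suc m)) a b (C : Weights (suc m)) →
                     restrict u (deleteAdj (punchIn u a) (punchIn u b) C) ≈ deleteAdj a b (restrict u C)
restrict-deleteAdj u a b C k l = begin
  deleteAdj (punchIn u a) (punchIn u b) C (punchIn u k) (punchIn u l)
    ≡⟨ deleteAdj-hits (punchIn u a) (punchIn u b) C (punchIn u k) (punchIn u l) ⟩
  (if hits (punchIn u a) (punchIn u b) (punchIn u k) (punchIn u l) then nothing else restrict u C k l)
    ≡⟨ cong (if_then nothing else restrict u C k l) hits-punchIn ⟩
  (if hits a b k l then nothing else restrict u C k l)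
    ≡⟨ deleteAdj-hits a b (restrict u C) k l ⟨
  deleteAdj a b (restrict u C) k l ∎
  where
    open ≡-Reasoning
    ≟-punchIn : ∀ x y → ⌊ punchIn u x ≟ punchIn u y ⌋ ≡ ⌊ x ≟ y ⌋
    ≟-punchIn x y with punchIn u x ≟ punchIn u y | x ≟ y
    ... | yes _  | yes _   = refl
    ... | yes p  | no x≢y  = contradiction (punchIn-injective u x y p) x≢y
    ... | no p≢q | yes x≡y = contradiction (cong (punchIn u) x≡y) p≢q
    ... | no _   | no _    = refl
    hits-punchIn : hits (punchIn u a) (punchIn u b) (punchIn u k) (punchIn u l) ≡ hits a b k l
    hits-punchIn rewrite ≟-punchIn k a | ≟-punchIn k b | ≟-punchIn l a | ≟-punchIn l b = refl

run-restrict : ∀ {m} {u : Fin (suc m)} {C : Weights (suc m)} {M} → Avoids u C → GreedyRun C M →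
               ∃ λ M′ → GreedyRun (restrict u C) M′ × weight M′ ≡ weight M
run-restrict avoids (done empty) = [] , done (λ k l → empty _ _) , refl
run-restrict {u = u} {C} avoids (step i j w eq max run)
  with preimage u i (proj₁ (avoids i j w eq)) | preimage u j (proj₂ (avoids i j w eq))
... | i′ , refl | j′ , refl
  with run-restrict (⊆-avoids (deleteAdj-⊆ (punchIn u i′) (punchIn u j′) C) avoids) run
...   | M′ , runM′ , same =
  (i′ , j′ , w) ∷ M′ ,
  step i′ j′ w eq (λ k l → max (punchIn u k) (punchIn u l)) (run-resp (restrict-deleteAdj u i′ j′ C) runM′) ,
  cong (w +_) same

≤+⇒-≤ : ∀ {x y z : ℚ} → x ≤ y + z → x - z ≤ y
≤+⇒-≤ {x} {y} {z} x≤y+z = begin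
  x + - z        ≤⟨ ℚ.+-monoˡ-≤ (- z) x≤y+z ⟩
  (y + z) + - z  ≡⟨ ℚ.+-assoc y z (- z) ⟩
  y + (z + - z)  ≡⟨ cong (y +_) (ℚ.+-inverseʳ z) ⟩
  y + 0ℚ         ≡⟨ ℚ.+-identityʳ y ⟩
  y ∎
  where open ℚ.≤-Reasoning

positive-nonNeg : ∀ {n} (G : WGraph n) → NonNeg (W G)
positive-nonNeg G k l w p = ℚ.<⇒≤ (ℚ.positive⁻¹ w {{pos G k l w p}})

lemma6 : (m : ℕ) (G : WGraph (suc m)) (w0 : ℚ) (u : Fin (suc m)) (opt opt' : ℚ) →
         IsMaxWeight G w0 → IsOPT G opt → IsOPT (G -v u) opt' →
         opt - w0 ≤ opt'
lemma6 m G w0 u _ opt' ((i , j , Gij) , bounded) ((M , runM , refl) , _) (_ , optimal′)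
  with isolate-loss u (positive-nonNeg G i j w0 Gij) (positive-nonNeg G) bounded runM
... | N , runN , loss
  with run-restrict (isolate-avoids u (W G)) runN
...   | N′ , runN′ , same = ≤+⇒-≤ (begin
    weight M       ≤⟨ loss ⟩
    weight N + w0  ≡⟨ cong (_+ w0) (sym same) ⟩
    weight N′ + w0 ≤⟨ ℚ.+-monoˡ-≤ w0 (optimal′ N′ (run-resp (restrict-isolate u (W G)) runN′)) ⟩
    opt' + w0      ∎)
  where open ℚ.≤-Reasoning
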